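{- Let $(\varepsilon,\lessdot)$ be a prioritized Extended Bundle Event Structure with $\varepsilon=(E,\leadsto,\mapsto,l)$, let $\langle C,\preceq_C,l|_C\rangle\in\mathrm{lposets}(\varepsilon)$, and let $\lessdot'=\lessdot\setminus\{(e,e')\in C\times C\mid e'\preceq_C e\}$. Then $\mathrm{Traces}(\varepsilon,\lessdot)|_C=\mathrm{Traces}(\varepsilon,\lessdot')|_C$.
   Context: An Extended Bundle Event Structure (EBES) is a quadruple $\varepsilon=(E,\leadsto,\mapsto,l)$ where $E$ is a set of events, $\leadsto\subseteq E\times E$ is an irreflexive relation (disabling; $e\leadsto e'$ means that once $e'$ has occurred, $e$ can no longer occur), $\mapsto\subseteq\mathcal{P}(E)\times E$ is the enabling relation (a pair $(X,e)$ is written $X\mapsto e$), and $l:E\to Act$ is a labeling function, satisfying Stability: whenever $X\mapsto e$, any two distinct $e_1,e_2\in X$ satisfy $e_1\leadsto e_2$. For a finite sequence $\sigma=e_1\cdots e_n$ write $\bar\sigma=\{e_1,\dots,e_n\}$, $\sigma_i=e_1\cdots e_i$ ($\sigma_0$ empty), and $\mathrm{en}_\varepsilon(\sigma)=\{e\in E\setminus\bar\sigma\mid(\forall X\subseteq E.\ X\mapsto e\Rightarrow X\cap\bar\sigma\neq\emptyset)\wedge\neg\exists e'\in\bar\sigma.\ e\leadsto e'\}$. $\sigma$ is a trace of $\varepsilon$ iff $e_i\in\mathrm{en}_\varepsilon(\sigma_{i-1})$ for all $1\le i\le n$. A set $C\subseteq E$ is a configuration of $\varepsilon$ iff $C=\bar\sigma$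 for some trace $\sigma$ of $\varepsilon$. For a configuration $C$, define $\prec_C\subseteq C\times C$ by $e\prec_C e'$ iff $(\exists X\subseteq E.\ X\mapsto e'\wedge e\in X)\vee e\leadsto e'$, and let $\preceq_C$ be the reflexive and transitive closure of $\prec_C$ on $C$. $\mathrm{lposets}(\varepsilon)$ is the set of triples $\langle C,\preceq_C,l|_C\rangle$ for all configurations $C$ of $\varepsilon$. A prioritized EBES (PEBES) is a pair $(\varepsilon,\lessdot)$ with $\lessdot\subseteq E\times E$ acyclic ($e\lessdot e'$: $e'$ has higher priority). $\sigma=e_1\cdots e_n$ is a trace of $(\varepsilon,\lessdot)$ iff $\sigma$ is a trace of $\varepsilon$ and for all $0\le i<n$ and all $e_j,e_h\in\bar\sigma$ with $e_j\neq e_h$, $e_j,e_h\in\mathrm{en}_\varepsilon(\sigma_i)$ and $e_h\lessdot e_j$, we have $j<h$; $\mathrm{Traces}(\varepsilon,\lessdot)$ is the set of these traces (same for subrelations of $\lessdot$), and $\mathrm{Traces}(\varepsilon,\lessdot)|_C=\{\sigma\in\mathrm{Traces}(\varepsilon,\lessdot)\mid\bar\sigma=C\}$. -}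

module Defs where

open import Data.Nat using (ℕ; _<_)
open import Data.Fin using (Fin; toℕ)
open import Data.List using (List; length; lookup; take)
open import Data.List.Membership.Propositional using (_∈_; _∉_)
open import Data.Product using (Σ; ∃; _×_; _,_)
open import Data.Sum using (_⊎_)
open import Data.Empty using (⊥)
open import Relation.Nullary using (¬_)
open import Relation.Binary.PropositionalEquality using (_≡_; _≢_)
open import Relation.Binary.Construct.Closure.Transitive using (TransClosure)
open import Relation.Binary.Construct.Closure.ReflexiveTransitive using (Star)
open import Function.Bundles using (_⇔_)

record EBES (Act : Set) : Set₂ where
  field
    E      : Set
    _⇝_    : E → E → Set
    _↦_    : (E → Set) → E → Set₁
    l      : E → Act
    ⇝-irrefl  : ∀ e → ¬ (e ⇝ e)
    stability : ∀ {X e} → X ↦ e → ∀ {e₁ e₂} → X e₁ → X e₂ → e₁ ≢ e₂ → e₁ ⇝ e₂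

module _ {Act : Set} (ε : EBES Act) where
  open EBES ε

  en : List E → E → Set₁
  en σ e = (e ∉ σ)
         × (∀ (X : E → Set) → X ↦ e → ∃ λ e' → (e' ∈ σ) × X e')
         × ¬ (∃ λ e' → (e' ∈ σ) × (e ⇝ e'))

  -- σ is a trace of ε : e_i ∈ en(σ_{i-1}) for all i (positions indexed from 0 here)
  IsTrace : List E → Set₁
  IsTrace σ = ∀ (i : Fin (length σ)) → en (take (toℕ i) σ) (lookup σ i)

  _HasSet_ : List E → (E → Set) → Set
  σ HasSet C = ∀ e → C e ⇔ (e ∈ σ)

  IsConfiguration : (E → Set) → Set₁
  IsConfiguration C = ∃ λ σ → IsTrace σ × (σ HasSet C)

  ≺[_] : (E → Set) → E → E → Set₁
  ≺[ C ] e e' = C e × C e' × ((∃ λ (X : E → Set) → (X ↦ e') × X e) ⊎ (e ⇝ e'))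

  -- ⪯_C : reflexive-transitive closure of ≺_C
  -- (reflexivity is also granted outside C; only pairs in C × C are ever used)
  ⪯[_] : (E → Set) → E → E → Set₁
  ⪯[ C ] = Star ≺[ C ]

  IsPTrace : (E → E → Set₁) → List E → Set₁
  IsPTrace _⋖_ σ =
    IsTrace σ ×
    (∀ (i : ℕ) → i < length σ → ∀ (j h : Fin (length σ)) →
       lookup σ j ≢ lookup σ h →
       en (take i σ) (lookup σ j) → en (take i σ) (lookup σ h) →
       lookup σ h ⋖ lookup σ j → toℕ j < toℕ h)

  removePrio : (E → Set) → (E → E → Set) → E → E → Set₁
  removePrio C _⋖_ e e' = (e ⋖ e') × ¬ (C e × C e' × ⪯[ C ] e' e)

  Lift₁ : (E → E → Set) → E → E → Set₁
  Lift₁ R e e' = Σ (R e e') (λ _ → Lift⊤)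
    where
      open import Data.Unit.Polymorphic using () renaming (⊤ to Lift⊤)

Acyclic : {A : Set} → (A → A → Set) → Set
Acyclic R = ∀ x → ¬ TransClosure R x x

-- In a trace, both causal relations point forward: a member of an enabling
-- bundle of e must occur before e (otherwise the bundle member occurring earlier
-- would, by stability, have disabled it), and if e ⇝ e' then e' cannot have
-- occurred before e. Hence e' ⪯_C e with e ≠ e' forces e' to precede e in every
-- trace through C, so each priority pair e ⋖ e' removed in ⋖' is one whose
-- constraint (e' before e) the trace satisfies anyway.
module Submission where

open import Defs
open import Data.List using (List; _∷_; length; lookup; take)
open import Data.List.Membership.Propositional using (_∈_; _∉_)
open import Data.List.Relation.Unary.Any using (here; there; index)
open import Data.List.Relation.Unary.Any.Properties using (lookup-index)
open import Data.Nat using (ℕ; suc; _<_; _≤_; s≤s)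
open import Data.Nat.Properties using (_<?_; ≮⇒≥; <⇒≤; <-≤-trans; ≤-reflexive; ≤∧≢⇒<)
open import Data.Fin using (Fin; toℕ)
open import Data.Fin.Properties using (<-cmp; toℕ-injective)
open import Data.Product using (_,_; proj₁; proj₂)
open import Data.Sum using (inj₁; inj₂)
open import Data.Empty using (⊥-elim)
open import Relation.Nullary using (¬_)
open import Function.Bundles using (_⇔_; mk⇔; Equivalence)
open import Relation.Binary.Definitions using (tri<; tri≈; tri>)
open import Relation.Binary.PropositionalEquality using (_≡_; _≢_; refl; sym; trans; cong; subst; subst₂)
open import Relation.Binary.Construct.Closure.ReflexiveTransitive using (ε; _◅_)
open import Relation.Nullary.Decidable using (decidable-stable)

module _ {A : Set} where

  lookup∈take : (xs : List A) (i : Fin (length xs)) {n : ℕ} → toℕ i < n → lookup xs i ∈ take n xs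
  lookup∈take (x ∷ xs) Fin.zero    {suc n} _         = here refl
  lookup∈take (x ∷ xs) (Fin.suc i) {suc n} (s≤s i<n) = there (lookup∈take xs i i<n)

  ∈-take-mono : (xs : List A) {m n : ℕ} → m ≤ n → ∀ {x} → x ∈ take m xs → x ∈ take n xs
  ∈-take-mono (y ∷ xs) {suc m} {suc n} _         (here x≡y)  = here x≡y
  ∈-take-mono (y ∷ xs) {suc m} {suc n} (s≤s m≤n) (there x∈xs) = there (∈-take-mono xs m≤n x∈xs)

module _ {Act : Set} (ℰ : EBES Act) where
  open EBES ℰ

  IsPTrace-antitone : ∀ {R S : E → E → Set₁} → (∀ {x y} → R x y → S x y) →
                      ∀ {σ} → IsPTrace ℰ S σ → IsPTrace ℰ R σ
  IsPTrace-antitone R⊆S (trace , prio) =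
    trace , λ i i<n j h ej≢eh en-j en-h Rhj → prio i i<n j h ej≢eh en-j en-h (R⊆S Rhj)

  removePrio⊆Lift₁ : ∀ C (_⋖_ : E → E → Set) {x y} → removePrio ℰ C _⋖_ x y → Lift₁ ℰ _⋖_ x y
  removePrio⊆Lift₁ _ _ (x⋖y , _) = x⋖y , _

  module _ {σ : List E} (trace : IsTrace ℰ σ) where

    fresh : ∀ a → lookup σ a ∉ take (toℕ a) σ
    fresh a = proj₁ (trace a)

    past-not-disabled : ∀ a {y} → y ∈ take (toℕ a) σ → ¬ (lookup σ a ⇝ y)
    past-not-disabled a y∈past a⇝y = proj₂ (proj₂ (trace a)) (_ , y∈past , a⇝y)

    lookup-injective : ∀ {a b} → lookup σ a ≡ lookup σ b → a ≡ b
    lookup-injective {a} {b} ea≡eb with <-cmp a b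
    ... | tri< a<b _ _ = ⊥-elim (fresh b (subst (_∈ take (toℕ b) σ) ea≡eb (lookup∈take σ a a<b)))
    ... | tri≈ _ a≡b _ = a≡b
    ... | tri> _ _ b<a = ⊥-elim (fresh a (subst (_∈ take (toℕ a) σ) (sym ea≡eb) (lookup∈take σ b b<a)))

    disabling-increasing : ∀ {a b} → lookup σ a ⇝ lookup σ b → toℕ a < toℕ b
    disabling-increasing {a} {b} a⇝b with <-cmp a b
    ... | tri< a<b _ _ = a<b
    ... | tri≈ _ refl _ = ⊥-elim (⇝-irrefl _ a⇝b)
    ... | tri> _ _ b<a = ⊥-elim (past-not-disabled a (lookup∈take σ b b<a) a⇝b)

    -- b occurred only after some x ∈ X; if a did not precede b, then x would
    -- precede a and, by stability, disable it.
    enabling-increasing : ∀ {X a b} → X ↦ lookup σ b → X (lookup σ a) → toℕ a < toℕ b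
    enabling-increasing {X} {a} {b} X↦b Xa with proj₁ (proj₂ (trace b)) X X↦b
    ... | x , x∈past-b , Xx = decidable-stable (toℕ a <? toℕ b) λ a≮b →
      let x∈past-a = ∈-take-mono σ (≮⇒≥ a≮b) x∈past-b
          ea≢x : lookup σ a ≢ x
          ea≢x ea≡x = fresh a (subst (_∈ take (toℕ a) σ) (sym ea≡x) x∈past-a)
      in past-not-disabled a x∈past-a (stability X↦b Xa Xx ea≢x)

    ≺-increasing : ∀ {C a b} → ≺[ ℰ ] C (lookup σ a) (lookup σ b) → toℕ a < toℕ b
    ≺-increasing (_ , _ , inj₁ (_ , X↦b , Xa)) = enabling-increasing X↦b Xa
    ≺-increasing (_ , _ , inj₂ a⇝b)            = disabling-increasing a⇝b

    module _ {C : E → Set} (C⊆σ : ∀ {e} → C e → e ∈ σ) where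

      ⪯-monotone : ∀ {x y} → ⪯[ ℰ ] C x y →
                   ∀ {a b} → lookup σ a ≡ x → lookup σ b ≡ y → toℕ a ≤ toℕ b
      ⪯-monotone ε ea≡x eb≡x =
        ≤-reflexive (cong toℕ (lookup-injective (trans ea≡x (sym eb≡x))))
      ⪯-monotone (_◅_ {j = z} x≺z z⪯y) ea≡x eb≡y =
        <⇒≤ (<-≤-trans (≺-increasing {C} (subst₂ (≺[ ℰ ] C) (sym ea≡x) z≡ez x≺z))
                       (⪯-monotone z⪯y (sym z≡ez) eb≡y))
        where
          z∈σ : z ∈ σ
          z∈σ = C⊆σ (proj₁ (proj₂ x≺z))

          z≡ez : z ≡ lookup σ (index z∈σ)
          z≡ez = lookup-index z∈σ

      ⪯-increasing : ∀ {a b} → lookup σ a ≢ lookup σ b → ⪯[ ℰ ] C (lookup σ a) (lookup σ b) →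
                     toℕ a < toℕ b
      ⪯-increasing ea≢eb a⪯b =
        ≤∧≢⇒< (⪯-monotone a⪯b refl refl) (λ a≡b → ea≢eb (cong (lookup σ) (toℕ-injective a≡b)))

theorem7 : ∀ {Act : Set} (ε : EBES Act) (_⋖_ : EBES.E ε → EBES.E ε → Set) →
    Acyclic _⋖_ →
    (C : EBES.E ε → Set) → IsConfiguration ε C →
    ∀ (σ : List (EBES.E ε)) → _HasSet_ ε σ C →
    IsPTrace ε (Lift₁ ε _⋖_) σ ⇔ IsPTrace ε (removePrio ε C _⋖_) σ
theorem7 ℰ _⋖_ _ C _ σ σ̄≡C = mk⇔ weaken restore
  where
    weaken : IsPTrace ℰ (Lift₁ ℰ _⋖_) σ → IsPTrace ℰ (removePrio ℰ C _⋖_) σ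
    weaken = IsPTrace-antitone ℰ {R = removePrio ℰ C _⋖_} (removePrio⊆Lift₁ ℰ C _⋖_)

    C⊆σ : ∀ {e} → C e → e ∈ σ
    C⊆σ {e} = Equivalence.to (σ̄≡C e)

    -- Unless already j < h, the pair (e_h, e_j) is not removed, so ⋖' itself forces j < h.
    restore : IsPTrace ℰ (removePrio ℰ C _⋖_) σ → IsPTrace ℰ (Lift₁ ℰ _⋖_) σ
    restore (trace , prio) = trace , λ i i<n j h ej≢eh en-j en-h (h⋖j , _) →
      decidable-stable (toℕ j <? toℕ h) λ j≮h →
        j≮h (prio i i<n j h ej≢eh en-j en-h
               (h⋖j , λ (_ , _ , j⪯h) → j≮h (⪯-increasing ℰ trace C⊆σ ej≢eh j⪯h)))
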